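{- Let $\mathbf{2}$ be the two-element NM chain. Let $\mathbf{A}$ be a finite NM$^-$ algebra and $\mathbf{p}$ a maximal prime filter of $\mathbf{A}$. Then the quotient $\mathbf{A}/\mathbf{p}$ is isomorphic to $\mathbf{2}$.
   Context: An NM algebra is an algebra $\langle A,\wedge,\vee,\odot,\to,\bot,\top\rangle$ such that $\langle A,\wedge,\vee,\bot,\top\rangle$ is a bounded lattice, $\langle A,\odot,\top\rangle$ is a commutative monoid, and: $x\odot y\le z$ iff $x\le y\to z$; $(x\to y)\vee(y\to x)=\top$; $\neg(x\odot y)\vee((x\wedge y)\to(x\odot y))=\top$; $\neg\neg x=x$, where $\neg x:=x\to\bot$. An NM$^-$ algebra is an NM algebra satisfying $\neg(\neg x^2)^2\leftrightarrow(\neg(\neg x)^2)^2=\top$, where $y^2=y\odot y$ and $a\leftrightarrow b=(a\to b)\odot(b\to a)$ (equivalently, an NM algebra with no $x$ such that $x=\neg x$). $\mathbf{2}=\{0,1\}$ with $\wedge=\odot=\min$, $\vee=\max$, $x\to y=1$ iff $x\le y$ (else $0$). A filter of $\mathbf{A}$ is a nonempty upward closed subset closed under $\odot$; it is prime if it is not all of $A$ and $x\vee y\in S$ implies $x\in S$ or $y\in S$. A maximal prime filter is a prime filter not properly contained in any other prime filter (equivalently, one generated by a minimal element among the idempotent join-irreducible elements). The quotient $\mathbf{A}/\mathbf{p}$ is by the congruence $x\sim y$ iff $(x\to y)\odot(y\to x)\in\mathbf{p}$. -}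

module Defs where

open import Data.Bool using (Bool; true; false)
open import Data.Nat using (ℕ)
open import Data.Fin using (Fin)
open import Data.Product using (Σ; ∃; _×_; _,_)
open import Data.Sum using (_⊎_)
open import Relation.Nullary using (¬_)
open import Relation.Binary.PropositionalEquality using (_≡_)
open import Function.Bundles using (_↔_; _⇔_)

record NMAlgebra : Set₁ where
  infixr 6 _∧_
  infixr 5 _∨_
  infixr 7 _⊙_
  infixr 4 _⇒_
  field
    Carrier : Set
    _∧_ _∨_ _⊙_ _⇒_ : Carrier → Carrier → Carrier
    ⊥ ⊤ : Carrier

  _≤_ : Carrier → Carrier → Set
  x ≤ y = x ∧ y ≡ x

  ¬′ : Carrier → Carrier
  ¬′ x = x ⇒ ⊥

  field
    ∧-assoc : ∀ x y z → (x ∧ y) ∧ z ≡ x ∧ (y ∧ z)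
    ∨-assoc : ∀ x y z → (x ∨ y) ∨ z ≡ x ∨ (y ∨ z)
    ∧-comm  : ∀ x y → x ∧ y ≡ y ∧ x
    ∨-comm  : ∀ x y → x ∨ y ≡ y ∨ x
    ∧-absorbs-∨ : ∀ x y → x ∧ (x ∨ y) ≡ x
    ∨-absorbs-∧ : ∀ x y → x ∨ (x ∧ y) ≡ x
    ⊥-least   : ∀ x → ⊥ ≤ x
    ⊤-greatest : ∀ x → x ≤ ⊤
    ⊙-assoc : ∀ x y z → (x ⊙ y) ⊙ z ≡ x ⊙ (y ⊙ z)
    ⊙-comm  : ∀ x y → x ⊙ y ≡ y ⊙ x
    ⊙-identityʳ : ∀ x → x ⊙ ⊤ ≡ x
    residuation : ∀ x y z → ((x ⊙ y) ≤ z) ⇔ (x ≤ (y ⇒ z))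
    prelinearity : ∀ x y → (x ⇒ y) ∨ (y ⇒ x) ≡ ⊤
    nm-axiom : ∀ x y → ¬′ (x ⊙ y) ∨ ((x ∧ y) ⇒ (x ⊙ y)) ≡ ⊤
    involutive : ∀ x → ¬′ (¬′ x) ≡ x

  sq : Carrier → Carrier
  sq y = y ⊙ y

  _⇔′_ : Carrier → Carrier → Carrier
  a ⇔′ b = (a ⇒ b) ⊙ (b ⇒ a)

IsNM⁻ : NMAlgebra → Set
IsNM⁻ A = ∀ x → (¬′ (sq (¬′ (sq x)))) ⇔′ (sq (¬′ (sq (¬′ x)))) ≡ ⊤
  where open NMAlgebra A

IsFinite : NMAlgebra → Set
IsFinite A = ∃ λ (n : ℕ) → Fin n ↔ NMAlgebra.Carrier A

module _ (A : NMAlgebra) where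
  open NMAlgebra A

  Subset : Set₁
  Subset = Carrier → Set

  record IsFilter (S : Subset) : Set where
    field
      nonempty : ∃ λ x → S x
      upward   : ∀ x y → S x → x ≤ y → S y
      ⊙-closed : ∀ x y → S x → S y → S (x ⊙ y)

  record IsPrimeFilter (S : Subset) : Set where
    field
      filter : IsFilter S
      proper : ∃ λ x → ¬ S x
      prime  : ∀ x y → S (x ∨ y) → S x ⊎ S y

  record IsMaximalPrimeFilter (S : Subset) : Set₁ where
    field
      primeFilter : IsPrimeFilter S
      maximal : ∀ (T : Subset) → IsPrimeFilter T →
                (∀ x → S x → T x) → (∀ x → T x → S x)

  _∼[_]_ : Carrier → Subset → Carrier → Set
  x ∼[ S ] y = S ((x ⇒ y) ⊙ (y ⇒ x))

-- The two-element NM chain 𝟐 = {0,1} on Bool (false = 0, true = 1)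
_∧₂_ : Bool → Bool → Bool
false ∧₂ _ = false
true  ∧₂ y = y

_∨₂_ : Bool → Bool → Bool
false ∨₂ y = y
true  ∨₂ _ = true

_⊙₂_ : Bool → Bool → Bool
_⊙₂_ = _∧₂_

_⇒₂_ : Bool → Bool → Bool
true ⇒₂ false = false
_    ⇒₂ _     = true

⊥₂ ⊤₂ : Bool
⊥₂ = false
⊤₂ = true

-- A/S ≅ 𝟐, expressed without quotient types: a map f : A → 𝟐 that
-- (i) preserves all operations, (ii) is surjective, and (iii) identifies
-- exactly the ∼[S]-related elements. Such f is precisely an isomorphism
-- A/S → 𝟐 (well-defined and injective by (iii), homomorphism by (i),
-- onto by (ii)).
module _ (A : NMAlgebra) where
  open NMAlgebra A

  record QuotientIso𝟐 (S : Subset A) : Set where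
    field
      f : Carrier → Bool
      f-∧ : ∀ x y → f (x ∧ y) ≡ f x ∧₂ f y
      f-∨ : ∀ x y → f (x ∨ y) ≡ f x ∨₂ f y
      f-⊙ : ∀ x y → f (x ⊙ y) ≡ f x ⊙₂ f y
      f-⇒ : ∀ x y → f (x ⇒ y) ≡ f x ⇒₂ f y
      f-⊥ : f ⊥ ≡ ⊥₂
      f-⊤ : f ⊤ ≡ ⊤₂
      f-surjective : ∀ b → ∃ λ x → f x ≡ b
      f-kernel : ∀ x y → (_∼[_]_ A x S y) ⇔ (f x ≡ f y)

module Submission where

-- Put δ x := ¬(¬x)².  In every NM algebra x ≤ δ x, and δ is monotone
-- and compatible with implication:  (x ⇒ y)² ≤ δ x ⇒ δ y.  In an NM⁻ algebra
-- moreover (δ x)² ≤ δ (x²).  These facts show that for any prime filter p the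
-- preimage δ⁻¹ p is again a prime filter, and it contains p.  If p is a
-- maximal prime filter this forces δ⁻¹ p = p.  Since (¬x ⇒ x) ≤ δ x, and
-- (by involutivity) (x ⇒ ¬x) ≤ δ ¬x, prelinearity then shows that a maximal
-- prime filter contains x or ¬x for every x.  Finally, for any prime filter
-- with that property, "x ∈ p" is decidable and its truth value is a
-- homomorphism onto 𝟐 whose kernel is exactly the congruence of p; this is
-- the isomorphism A/p ≅ 𝟐.

open import Defs
open import Algebra.Bundles using (CommutativeSemigroup)
open import Algebra.Lattice.Bundles using (Lattice)
import Algebra.Properties.CommutativeSemigroup as CommutativeSemigroupProperties
open import Algebra.Lattice.Properties.Lattice using (∨-∧-orderTheoreticLattice)
open import Data.Bool using (Bool; true; false)
open import Data.Product using (_,_)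
open import Data.Sum using (_⊎_; inj₁; inj₂)
import Data.Sum as Sum
open import Function.Base using (id)
open import Function.Bundles using (mk⇔; Equivalence)
open import Relation.Binary.Bundles using (Poset)
import Relation.Binary.Lattice.Bundles as OrderTheoretic
import Relation.Binary.Reasoning.PartialOrder
open import Relation.Nullary using (¬_; Dec; yes; no; does; contradiction)
open import Relation.Nullary.Decidable using (dec-true; dec-false)
open import Relation.Binary.PropositionalEquality
  using (_≡_; refl; sym; trans; cong; cong₂; subst; isEquivalence)

module NMAlgebraProperties (A : NMAlgebra) where
  open NMAlgebra A

  -- The order x ≤ y :⇔ x ∧ y ≡ x is the (flipped) natural order of the
  -- underlying lattice, so the standard library provides its lattice laws.
  private
    lattice : Lattice _ _
    lattice = record
      { Carrier = Carrier ; _≈_ = _≡_ ; _∨_ = _∨_ ; _∧_ = _∧_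
      ; isLattice = record
        { isEquivalence = isEquivalence
        ; ∨-comm = ∨-comm ; ∨-assoc = ∨-assoc ; ∨-cong = cong₂ _∨_
        ; ∧-comm = ∧-comm ; ∧-assoc = ∧-assoc ; ∧-cong = cong₂ _∧_
        ; absorptive = ∨-absorbs-∧ , ∧-absorbs-∨ } }

    module L = OrderTheoretic.Lattice (∨-∧-orderTheoreticLattice lattice)

    ⊙-commutativeSemigroup : CommutativeSemigroup _ _
    ⊙-commutativeSemigroup = record
      { Carrier = Carrier ; _≈_ = _≡_ ; _∙_ = _⊙_
      ; isCommutativeSemigroup = record
        { isSemigroup = record
          { isMagma = record { isEquivalence = isEquivalence ; ∙-cong = cong₂ _⊙_ }
          ; assoc = ⊙-assoc }
        ; comm = ⊙-comm } }

  open CommutativeSemigroupProperties ⊙-commutativeSemigroup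
    using (interchange)

  ≤-reflexive : ∀ {x y} → x ≡ y → x ≤ y
  ≤-reflexive x≡y = sym (L.reflexive x≡y)

  ≤-trans : ∀ {x y z} → x ≤ y → y ≤ z → x ≤ z
  ≤-trans x≤y y≤z = sym (L.trans (sym x≤y) (sym y≤z))

  ≤-antisym : ∀ {x y} → x ≤ y → y ≤ x → x ≡ y
  ≤-antisym x≤y y≤x = L.antisym (sym x≤y) (sym y≤x)

  poset : Poset _ _ _
  poset = record
    { _≈_ = _≡_ ; _≤_ = _≤_
    ; isPartialOrder = record
      { isPreorder = record
        { isEquivalence = isEquivalence ; reflexive = ≤-reflexive ; trans = ≤-trans }
      ; antisym = ≤-antisym } }

  module ≤-Reasoning = Relation.Binary.Reasoning.PartialOrder poset

  ≤-refl : ∀ {x} → x ≤ x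
  ≤-refl = ≤-reflexive refl

  x∧y≤x : ∀ x y → (x ∧ y) ≤ x
  x∧y≤x x y = sym (L.x∧y≤x x y)

  x∧y≤y : ∀ x y → (x ∧ y) ≤ y
  x∧y≤y x y = sym (L.x∧y≤y x y)

  ∧-greatest : ∀ {x y z} → x ≤ y → x ≤ z → x ≤ (y ∧ z)
  ∧-greatest x≤y x≤z = sym (L.∧-greatest (sym x≤y) (sym x≤z))

  x≤x∨y : ∀ x y → x ≤ (x ∨ y)
  x≤x∨y x y = sym (L.x≤x∨y x y)

  y≤x∨y : ∀ x y → y ≤ (x ∨ y)
  y≤x∨y x y = sym (L.y≤x∨y x y)

  ∨-least : ∀ {x y z} → x ≤ z → y ≤ z → (x ∨ y) ≤ z
  ∨-least x≤z y≤z = sym (L.∨-least (sym x≤z) (sym y≤z))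

  open ≤-Reasoning

  ⇒-intro : ∀ {x y z} → (x ⊙ y) ≤ z → x ≤ (y ⇒ z)
  ⇒-intro = Equivalence.to (residuation _ _ _)

  ⇒-elim : ∀ {x y z} → x ≤ (y ⇒ z) → (x ⊙ y) ≤ z
  ⇒-elim = Equivalence.from (residuation _ _ _)

  modus-ponens : ∀ x y → ((x ⇒ y) ⊙ x) ≤ y
  modus-ponens x y = ⇒-elim ≤-refl

  ⊙-identityˡ : ∀ x → ⊤ ⊙ x ≡ x
  ⊙-identityˡ x = trans (⊙-comm ⊤ x) (⊙-identityʳ x)

  -- Multiplication is monotone, since it is left adjoint to ⇒.
  ⊙-monoˡ : ∀ {x y} z → x ≤ y → (x ⊙ z) ≤ (y ⊙ z)
  ⊙-monoˡ z x≤y = ⇒-elim (≤-trans x≤y (⇒-intro ≤-refl))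

  ⊙-mono : ∀ {a b c d} → a ≤ b → c ≤ d → (a ⊙ c) ≤ (b ⊙ d)
  ⊙-mono {a} {b} {c} {d} a≤b c≤d = begin
    a ⊙ c  ≤⟨ ⊙-monoˡ c a≤b ⟩
    b ⊙ c  ≡⟨ ⊙-comm b c ⟩
    c ⊙ b  ≤⟨ ⊙-monoˡ b c≤d ⟩
    d ⊙ b  ≡⟨ ⊙-comm d b ⟩
    b ⊙ d  ∎

  x⊙y≤x : ∀ x y → (x ⊙ y) ≤ x
  x⊙y≤x x y = begin
    x ⊙ y  ≤⟨ ⊙-mono ≤-refl (⊤-greatest y) ⟩
    x ⊙ ⊤  ≡⟨ ⊙-identityʳ x ⟩
    x      ∎

  x⊙y≤y : ∀ x y → (x ⊙ y) ≤ y
  x⊙y≤y x y = begin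
    x ⊙ y  ≡⟨ ⊙-comm x y ⟩
    y ⊙ x  ≤⟨ x⊙y≤x y x ⟩
    y      ∎

  -- Multiplication distributes over joins, since it is a left adjoint.
  ⊙-∨-least : ∀ {z a b w} → (z ⊙ a) ≤ w → (z ⊙ b) ≤ w → (z ⊙ (a ∨ b)) ≤ w
  ⊙-∨-least {z} {a} {b} {w} za≤w zb≤w = begin
    z ⊙ (a ∨ b)  ≡⟨ ⊙-comm z (a ∨ b) ⟩
    (a ∨ b) ⊙ z  ≤⟨ ⇒-elim (∨-least (⇒-intro (flip a za≤w)) (⇒-intro (flip b zb≤w))) ⟩
    w            ∎
    where
    flip : ∀ c → (z ⊙ c) ≤ w → (c ⊙ z) ≤ w
    flip c zc≤w = ≤-trans (≤-reflexive (⊙-comm c z)) zc≤w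

  y≤x⇒y : ∀ x y → y ≤ (x ⇒ y)
  y≤x⇒y x y = ⇒-intro (x⊙y≤x y x)

  ⇒-∨ : ∀ x y → (x ⇒ y) ≤ ((x ∨ y) ⇒ y)
  ⇒-∨ x y = ⇒-intro (⊙-∨-least (modus-ponens x y) (x⊙y≤y (x ⇒ y) y))

  ⇒-∧ : ∀ x y → (x ⇒ y) ≤ (x ⇒ (x ∧ y))
  ⇒-∧ x y = ⇒-intro (∧-greatest (x⊙y≤y (x ⇒ y) x) (modus-ponens x y))

  ¬x≤x⇒y : ∀ x y → ¬′ x ≤ (x ⇒ y)
  ¬x≤x⇒y x y = ⇒-intro (≤-trans (modus-ponens x ⊥) (⊥-least y))

  ¬x⊙x≤⊥ : ∀ x → (¬′ x ⊙ x) ≤ ⊥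
  ¬x⊙x≤⊥ x = modus-ponens x ⊥

  x⊙¬x≤⊥ : ∀ x → (x ⊙ ¬′ x) ≤ ⊥
  x⊙¬x≤⊥ x = ≤-trans (≤-reflexive (⊙-comm x (¬′ x))) (¬x⊙x≤⊥ x)

  ¬⊥≡⊤ : ¬′ ⊥ ≡ ⊤
  ¬⊥≡⊤ = ≤-antisym (⊤-greatest _) (⇒-intro (≤-reflexive (⊙-identityˡ ⊥)))

  ¬-antitone : ∀ {a b} → a ≤ b → ¬′ b ≤ ¬′ a
  ¬-antitone {a} {b} a≤b = ⇒-intro (≤-trans (⊙-mono ≤-refl a≤b) (¬x⊙x≤⊥ b))

  contraposition : ∀ x y → (x ⇒ y) ≤ (¬′ y ⇒ ¬′ x)
  contraposition x y = ⇒-intro (⇒-intro (begin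
    ((x ⇒ y) ⊙ ¬′ y) ⊙ x  ≡⟨ cong (_⊙ x) (⊙-comm (x ⇒ y) (¬′ y)) ⟩
    (¬′ y ⊙ (x ⇒ y)) ⊙ x  ≡⟨ ⊙-assoc (¬′ y) (x ⇒ y) x ⟩
    ¬′ y ⊙ ((x ⇒ y) ⊙ x)  ≤⟨ ⊙-mono ≤-refl (modus-ponens x y) ⟩
    ¬′ y ⊙ y              ≤⟨ ¬x⊙x≤⊥ y ⟩
    ⊥                     ∎))

  sq-mono : ∀ {a b} → a ≤ b → sq a ≤ sq b
  sq-mono a≤b = ⊙-mono a≤b a≤b

  sq-⇒ : ∀ x y → sq (x ⇒ y) ≤ (sq x ⇒ sq y)
  sq-⇒ x y = ⇒-intro (begin
    sq (x ⇒ y) ⊙ sq x              ≡⟨ interchange (x ⇒ y) (x ⇒ y) x x ⟩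
    ((x ⇒ y) ⊙ x) ⊙ ((x ⇒ y) ⊙ x)  ≤⟨ sq-mono (modus-ponens x y) ⟩
    sq y                            ∎)

  δ : Carrier → Carrier
  δ x = ¬′ (sq (¬′ x))

  δ-mono : ∀ {a b} → a ≤ b → δ a ≤ δ b
  δ-mono a≤b = ¬-antitone (sq-mono (¬-antitone a≤b))

  x≤δx : ∀ x → x ≤ δ x
  x≤δx x = ⇒-intro (begin
    x ⊙ sq (¬′ x)  ≤⟨ ⊙-mono ≤-refl (x⊙y≤x (¬′ x) (¬′ x)) ⟩
    x ⊙ ¬′ x       ≤⟨ x⊙¬x≤⊥ x ⟩
    ⊥              ∎)

  δ⊥≤⊥ : δ ⊥ ≤ ⊥
  δ⊥≤⊥ = begin
    ¬′ (sq (¬′ ⊥))  ≡⟨ cong (λ t → ¬′ (sq t)) ¬⊥≡⊤ ⟩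
    ¬′ (⊤ ⊙ ⊤)      ≡⟨ cong ¬′ (⊙-identityʳ ⊤) ⟩
    ¬′ ⊤            ≡⟨ sym (⊙-identityʳ (¬′ ⊤)) ⟩
    ¬′ ⊤ ⊙ ⊤        ≤⟨ ¬x⊙x≤⊥ ⊤ ⟩
    ⊥               ∎

  ¬x⇒x≤δx : ∀ x → (¬′ x ⇒ x) ≤ δ x
  ¬x⇒x≤δx x = ⇒-intro (begin
    (¬′ x ⇒ x) ⊙ sq (¬′ x)        ≡⟨ sym (⊙-assoc (¬′ x ⇒ x) (¬′ x) (¬′ x)) ⟩
    ((¬′ x ⇒ x) ⊙ ¬′ x) ⊙ ¬′ x    ≤⟨ ⊙-monoˡ (¬′ x) (modus-ponens (¬′ x) x) ⟩
    x ⊙ ¬′ x                      ≤⟨ x⊙¬x≤⊥ x ⟩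
    ⊥                             ∎)

  δ-⇒ : ∀ x y → sq (x ⇒ y) ≤ (δ x ⇒ δ y)
  δ-⇒ x y = begin
    sq (x ⇒ y)                         ≤⟨ sq-mono (contraposition x y) ⟩
    sq (¬′ y ⇒ ¬′ x)                   ≤⟨ sq-⇒ (¬′ y) (¬′ x) ⟩
    sq (¬′ y) ⇒ sq (¬′ x)              ≤⟨ contraposition (sq (¬′ y)) (sq (¬′ x)) ⟩
    ¬′ (sq (¬′ x)) ⇒ ¬′ (sq (¬′ y))    ∎

  -- In an NM⁻ algebra δ is submultiplicative on squares: (δ x)² ≤ δ (x²).
  -- This is the half of the defining NM⁻ equation that the proof needs.
  sq-δ≤δ-sq : IsNM⁻ A → ∀ x → sq (δ x) ≤ δ (sq x)
  sq-δ≤δ-sq nm x = begin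
    sq (δ x)                                  ≡⟨ sym (⊙-identityˡ (sq (δ x))) ⟩
    ⊤ ⊙ sq (δ x)                              ≡⟨ cong (_⊙ sq (δ x)) (sym (nm x)) ⟩
    (δ (sq x) ⇔′ sq (δ x)) ⊙ sq (δ x)        ≤⟨ ⊙-monoˡ (sq (δ x)) (x⊙y≤y _ _) ⟩
    (sq (δ x) ⇒ δ (sq x)) ⊙ sq (δ x)         ≤⟨ modus-ponens (sq (δ x)) (δ (sq x)) ⟩
    δ (sq x)                                  ∎

  x⇒¬x≤δ¬x : ∀ x → (x ⇒ ¬′ x) ≤ δ (¬′ x)
  x⇒¬x≤δ¬x x = subst (λ t → (t ⇒ ¬′ x) ≤ δ (¬′ x)) (involutive x) (¬x⇒x≤δx (¬′ x))

module PrimeFilterProperties (A : NMAlgebra) {p : Subset A} (p-prime : IsPrimeFilter A p) where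
  open NMAlgebra A
  open NMAlgebraProperties A
  open IsPrimeFilter p-prime
  open IsFilter filter

  ∈-up : ∀ {x y} → p x → x ≤ y → p y
  ∈-up = upward _ _

  ∈-⊙ : ∀ {x y} → p x → p y → p (x ⊙ y)
  ∈-⊙ = ⊙-closed _ _

  ⊤∈p : p ⊤
  ⊤∈p = let (x , x∈p) = nonempty in ∈-up x∈p (⊤-greatest x)

  ⊥∉p : ¬ p ⊥
  ⊥∉p ⊥∈p = let (x , x∉p) = proper in x∉p (∈-up ⊥∈p (⊥-least x))

  ∈-modus-ponens : ∀ {x y} → p x → p (x ⇒ y) → p y
  ∈-modus-ponens {x} {y} x∈p x⇒y∈p = ∈-up (∈-⊙ x⇒y∈p x∈p) (modus-ponens x y)

  ∈-linear : ∀ x y → p (x ⇒ y) ⊎ p (y ⇒ x)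
  ∈-linear x y = prime _ _ (subst p (sym (prelinearity x y)) ⊤∈p)

  ∈-δ-⇒ : ∀ {x y} → p (x ⇒ y) → p (δ x ⇒ δ y)
  ∈-δ-⇒ {x} {y} x⇒y∈p = ∈-up (∈-⊙ x⇒y∈p x⇒y∈p) (δ-⇒ x y)

  ¬∈p⇒∉p : ∀ {x} → p (¬′ x) → ¬ p x
  ¬∈p⇒∉p ¬x∈p x∈p = ⊥∉p (∈-modus-ponens x∈p ¬x∈p)

module _ (A : NMAlgebra) where
  open NMAlgebra A
  open NMAlgebraProperties A
  open ≤-Reasoning

  δ-preimage : Subset A → Subset A
  δ-preimage p x = p (δ x)

  δ-preimage-prime : IsNM⁻ A → ∀ {p} → IsPrimeFilter A p → IsPrimeFilter A (δ-preimage p)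
  δ-preimage-prime nm {p} p-prime = record
    { filter = record
      { nonempty = ⊤ , ∈-up ⊤∈p (x≤δx ⊤)
      ; upward   = λ x y δx∈p x≤y → ∈-up δx∈p (δ-mono x≤y)
      ; ⊙-closed = δ-∈-⊙ }
    ; proper = ⊥ , λ δ⊥∈p → ⊥∉p (∈-up δ⊥∈p δ⊥≤⊥)
    ; prime  = δ-∈-prime }
    where
    open PrimeFilterProperties A p-prime

    δ-∈-transport : ∀ {x y} → p (x ⇒ y) → p (δ x) → p (δ y)
    δ-∈-transport x⇒y∈p δx∈p = ∈-modus-ponens δx∈p (∈-δ-⇒ x⇒y∈p)

    δ-∈-prime : ∀ x y → p (δ (x ∨ y)) → p (δ x) ⊎ p (δ y)
    δ-∈-prime x y δx∨y∈p with ∈-linear x y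
    ... | inj₁ x⇒y∈p = inj₂ (δ-∈-transport (∈-up x⇒y∈p (⇒-∨ x y)) δx∨y∈p)
    ... | inj₂ y⇒x∈p = inj₁ (δ-∈-transport (∈-up y⇒x∈p (⇒-∨ y x)) δy∨x∈p)
      where
      δy∨x∈p : p (δ (y ∨ x))
      δy∨x∈p = subst (λ t → p (δ t)) (∨-comm x y) δx∨y∈p

    δ-∈-∧ : ∀ x y → p (δ x) → p (δ y) → p (δ (x ∧ y))
    δ-∈-∧ x y δx∈p δy∈p with ∈-linear x y
    ... | inj₁ x⇒y∈p = δ-∈-transport (∈-up x⇒y∈p (⇒-∧ x y)) δx∈p
    ... | inj₂ y⇒x∈p = subst (λ t → p (δ t)) (∧-comm y x)
                         (δ-∈-transport (∈-up y⇒x∈p (⇒-∧ y x)) δy∈p)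

    δ-∈-⊙ : ∀ x y → p (δ x) → p (δ y) → p (δ (x ⊙ y))
    δ-∈-⊙ x y δx∈p δy∈p = ∈-up (∈-⊙ δx∧y∈p δx∧y∈p) (begin
      sq (δ (x ∧ y))  ≤⟨ sq-δ≤δ-sq nm (x ∧ y) ⟩
      δ (sq (x ∧ y))  ≤⟨ δ-mono (⊙-mono (x∧y≤x x y) (x∧y≤y x y)) ⟩
      δ (x ⊙ y)       ∎)
      where
      δx∧y∈p : p (δ (x ∧ y))
      δx∧y∈p = δ-∈-∧ x y δx∈p δy∈p

  -- A maximal prime filter p of an NM⁻ algebra is closed under δ-preimages,
  -- because δ⁻¹ p is a prime filter containing p.
  δ-preimage⊆maximal : IsNM⁻ A → ∀ {p} → IsMaximalPrimeFilter A p →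
                       ∀ x → δ-preimage p x → p x
  δ-preimage⊆maximal nm {p} p-max =
    maximal (δ-preimage p) (δ-preimage-prime nm primeFilter)
            (λ y y∈p → ∈-up y∈p (x≤δx y))
    where
    open IsMaximalPrimeFilter p-max
    open PrimeFilterProperties A primeFilter

  -- Hence it contains x or ¬x for every x: δ x lies above ¬x ⇒ x, δ ¬x lies
  -- above x ⇒ ¬x, and one of these two implications lies in p.
  maximal-dichotomy : IsNM⁻ A → ∀ {p} → IsMaximalPrimeFilter A p → ∀ x → p x ⊎ p (¬′ x)
  maximal-dichotomy nm {p} p-max x =
    Sum.map (λ ¬x⇒x∈p → δ⁻¹p⊆p x (∈-up ¬x⇒x∈p (¬x⇒x≤δx x)))
            (λ x⇒¬x∈p → δ⁻¹p⊆p (¬′ x) (∈-up x⇒¬x∈p (x⇒¬x≤δ¬x x)))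
            (∈-linear (¬′ x) x)
    where
    open PrimeFilterProperties A (IsMaximalPrimeFilter.primeFilter p-max)

    δ⁻¹p⊆p : ∀ y → δ-preimage p y → p y
    δ⁻¹p⊆p = δ-preimage⊆maximal nm p-max

  quotient-onto-𝟐 : ∀ {p} → IsPrimeFilter A p → (∀ x → p x ⊎ p (¬′ x)) →
                    QuotientIso𝟐 A p
  quotient-onto-𝟐 {p} p-prime dichotomy = record
    { f = χ
    ; f-∧ = χ-∧
    ; f-∨ = χ-∨
    ; f-⊙ = χ-⊙
    ; f-⇒ = χ-⇒
    ; f-⊥ = χ-false ⊥∉p
    ; f-⊤ = χ-true ⊤∈p
    ; f-surjective = λ { true → ⊤ , χ-true ⊤∈p ; false → ⊥ , χ-false ⊥∉p }
    ; f-kernel = λ x y → mk⇔ (∼⇒χ≡ x y) (χ≡⇒∼ x y) }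
    where
    open PrimeFilterProperties A p-prime
    open IsPrimeFilter p-prime using (prime)

    p? : ∀ x → Dec (p x)
    p? x with dichotomy x
    ... | inj₁ x∈p  = yes x∈p
    ... | inj₂ ¬x∈p = no (¬∈p⇒∉p ¬x∈p)

    χ : Carrier → Bool
    χ x = does (p? x)

    χ-true : ∀ {x} → p x → χ x ≡ true
    χ-true {x} = dec-true (p? x)

    χ-false : ∀ {x} → ¬ p x → χ x ≡ false
    χ-false {x} = dec-false (p? x)

    ∉p⇒¬∈p : ∀ {x} → ¬ p x → p (¬′ x)
    ∉p⇒¬∈p {x} x∉p = Sum.[ (λ x∈p → contradiction x∈p x∉p) , id ] (dichotomy x)

    χ-∧ : ∀ x y → χ (x ∧ y) ≡ χ x ∧₂ χ y
    χ-∧ x y with p? x | p? y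
    ... | yes x∈p | yes y∈p = χ-true (∈-up (∈-⊙ x∈p y∈p) (∧-greatest (x⊙y≤x x y) (x⊙y≤y x y)))
    ... | yes _   | no y∉p  = χ-false (λ x∧y∈p → y∉p (∈-up x∧y∈p (x∧y≤y x y)))
    ... | no x∉p  | _       = χ-false (λ x∧y∈p → x∉p (∈-up x∧y∈p (x∧y≤x x y)))

    χ-∨ : ∀ x y → χ (x ∨ y) ≡ χ x ∨₂ χ y
    χ-∨ x y with p? x | p? y
    ... | yes x∈p | _       = χ-true (∈-up x∈p (x≤x∨y x y))
    ... | no _    | yes y∈p = χ-true (∈-up y∈p (y≤x∨y x y))
    ... | no x∉p  | no y∉p  = χ-false (λ x∨y∈p → Sum.[ x∉p , y∉p ] (prime x y x∨y∈p))

    χ-⊙ : ∀ x y → χ (x ⊙ y) ≡ χ x ⊙₂ χ y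
    χ-⊙ x y with p? x | p? y
    ... | yes x∈p | yes y∈p = χ-true (∈-⊙ x∈p y∈p)
    ... | yes _   | no y∉p  = χ-false (λ x⊙y∈p → y∉p (∈-up x⊙y∈p (x⊙y≤y x y)))
    ... | no x∉p  | _       = χ-false (λ x⊙y∈p → x∉p (∈-up x⊙y∈p (x⊙y≤x x y)))

    χ-⇒ : ∀ x y → χ (x ⇒ y) ≡ χ x ⇒₂ χ y
    χ-⇒ x y with p? x | p? y
    ... | yes _   | yes y∈p = χ-true (∈-up y∈p (y≤x⇒y x y))
    ... | yes x∈p | no y∉p  = χ-false (λ x⇒y∈p → y∉p (∈-modus-ponens x∈p x⇒y∈p))
    ... | no _    | yes y∈p = χ-true (∈-up y∈p (y≤x⇒y x y))
    ... | no x∉p  | no _    = χ-true (∈-up (∉p⇒¬∈p x∉p) (¬x≤x⇒y x y))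

    ∼⇒χ≡ : ∀ x y → _∼[_]_ A x p y → χ x ≡ χ y
    ∼⇒χ≡ x y x∼y with p? x | p? y
    ... | yes _   | yes _   = refl
    ... | yes x∈p | no y∉p  = contradiction (∈-modus-ponens x∈p (∈-up x∼y (x⊙y≤x _ _))) y∉p
    ... | no x∉p  | yes y∈p = contradiction (∈-modus-ponens y∈p (∈-up x∼y (x⊙y≤y _ _))) x∉p
    ... | no _    | no _    = refl

    χ≡⇒∼ : ∀ x y → χ x ≡ χ y → _∼[_]_ A x p y
    χ≡⇒∼ x y χx≡χy with p? x | p? y
    ... | yes x∈p | yes y∈p = ∈-⊙ (∈-up y∈p (y≤x⇒y x y)) (∈-up x∈p (y≤x⇒y y x))
    ... | no x∉p  | no y∉p  = ∈-⊙ (∈-up (∉p⇒¬∈p x∉p) (¬x≤x⇒y x y)) (∈-up (∉p⇒¬∈p y∉p) (¬x≤x⇒y y x))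
    ... | yes _   | no _    with () ← χx≡χy
    ... | no _    | yes _   with () ← χx≡χy

lemma4 : (A : NMAlgebra) → IsFinite A → IsNM⁻ A →
    (p : Subset A) → IsMaximalPrimeFilter A p → QuotientIso𝟐 A p
lemma4 A _ nm p p-max =
  quotient-onto-𝟐 A (IsMaximalPrimeFilter.primeFilter p-max)
                    (maximal-dichotomy A nm p-max)
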